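{- Let $\gamma$ be the morphism on $\{a,b,c\}^*$ given by $a\mapsto aca$, $b\mapsto cab$, $c\mapsto b$, and let ${\bf x}_\gamma$ be its fixed point starting with $a$. Then ${\bf x}_\gamma$ is palindromic.
   Context: The fixed point is $\lim_n\gamma^n(a)$. A right-infinite word is palindromic if its set of (finite) factors contains arbitrarily long palindromes. -}

module Defs where

open import Data.Nat using (ℕ; zero; suc; _+_)
open import Data.List using (List; []; _∷_; _++_; concatMap; reverse; length)
open import Data.Product using (Σ; _×_; ∃)
open import Relation.Binary.PropositionalEquality using (_≡_)
open import Data.Nat using (_≥_)

data Letter : Set where
  a b c : Letter

γ : Letter → List Letter
γ a = a ∷ c ∷ a ∷ []
γ b = c ∷ a ∷ b ∷ []
γ c = b ∷ []

γ* : List Letter → List Letter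
γ* = concatMap γ

γⁿa : ℕ → List Letter
γⁿa zero    = a ∷ []
γⁿa (suc n) = γ* (γⁿa n)

at : List Letter → ℕ → Letter
at []       _       = a
at (x ∷ _)  zero    = x
at (_ ∷ xs) (suc i) = at xs i

-- The fixed point x_γ = lim γ^n(a), as a right-infinite word ℕ → Letter.
-- Since γ(a) starts with a, γ^n(a) is a prefix of γ^(n+1)(a), and
-- |γ^(i+1)(a)| ≥ i+1, so position i is already determined by γ^(i+1)(a)
-- (the default in `at` is never used).
xγ : ℕ → Letter
xγ i = at (γⁿa (suc i)) i

window : (ℕ → Letter) → ℕ → ℕ → List Letter
window x i zero    = []
window x i (suc n) = x i ∷ window x (suc i) n

IsFactor : List Letter → (ℕ → Letter) → Set
IsFactor w x = ∃ λ i → window x i (length w) ≡ w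

IsPalindrome : List Letter → Set
IsPalindrome w = reverse w ≡ w

Palindromic : (ℕ → Letter) → Set
Palindromic x = ∀ (n : ℕ) → Σ (List Letter) λ w →
  (length w ≥ n) × IsFactor w x × IsPalindrome w

-- Let θ be the morphism a ↦ b, b ↦ acaca, c ↦ aca, whose letter images are
-- palindromes, so θ maps palindromes to palindromes. On words P ∈ a({b,c}a)⁺
-- it is conjugate to γ: b·γ(P) = θ(P)·aca. Such a P maps to θ(P) = bQb with Q
-- again in a({b,c}a)⁺, hence γ(P) = Q·baca. So if P is a palindromic factor of
-- γⁿ(a), then Q is a palindromic factor of γⁿ⁺¹(a) of length about 2|P|.
-- Starting from γ²(a) = acabaca this yields arbitrarily long palindromes.
module Submission where

open import Defs
open import Data.Nat using (ℕ; zero; suc; _+_; _≤_; _<_; _≤′_; ≤′-refl; ≤′-step; z≤n; s≤s)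
open import Data.Nat.Properties
open import Data.List using (List; []; _∷_; _++_; _∷ʳ_; concatMap; reverse; length; [_])
open import Data.List.Properties
  using (++-identityʳ; ++-assoc; concatMap-++; reverse-++; ∷-injectiveʳ; ∷ʳ-injective; unfold-reverse; length-++)
open import Data.Product using (∃; ∃₂; _,_; proj₁)
open import Data.Sum using (inj₁; inj₂)
open import Relation.Binary.PropositionalEquality hiding ([_])

reverse-concatMap : ∀ {A B : Set} (f : A → List B) → (∀ x → reverse (f x) ≡ f x) →
                    ∀ w → reverse (concatMap f w) ≡ concatMap f (reverse w)
reverse-concatMap f f-pal [] = refl
reverse-concatMap f f-pal (x ∷ w) = begin
  reverse (f x ++ concatMap f w)              ≡⟨ reverse-++ (f x) (concatMap f w) ⟩
  reverse (concatMap f w) ++ reverse (f x)    ≡⟨ cong₂ _++_ (reverse-concatMap f f-pal w) (f-pal x) ⟩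
  concatMap f (reverse w) ++ f x              ≡⟨ cong (concatMap f (reverse w) ++_) (sym (++-identityʳ (f x))) ⟩
  concatMap f (reverse w) ++ concatMap f [ x ] ≡⟨ concatMap-++ f (reverse w) [ x ] ⟨
  concatMap f (reverse w ++ [ x ])            ≡⟨ cong (concatMap f) (reverse-++ [ x ] w) ⟨
  concatMap f (reverse (x ∷ w))               ∎
  where open ≡-Reasoning

palindrome-strip : ∀ x Q → IsPalindrome (x ∷ Q ++ [ x ]) → IsPalindrome Q
palindrome-strip x Q pal = ∷-injectiveʳ (proj₁ (∷ʳ-injective (x ∷ reverse Q) (x ∷ Q) (begin
  (x ∷ reverse Q) ∷ʳ x           ≡⟨ cong (_∷ʳ x) (reverse-++ Q [ x ]) ⟨
  reverse (Q ++ [ x ]) ∷ʳ x      ≡⟨ unfold-reverse x (Q ++ [ x ]) ⟨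
  reverse (x ∷ Q ++ [ x ])       ≡⟨ pal ⟩
  x ∷ Q ++ [ x ]                 ∎)))
  where open ≡-Reasoning

θ : Letter → List Letter
θ a = b ∷ []
θ b = a ∷ c ∷ a ∷ c ∷ a ∷ []
θ c = a ∷ c ∷ a ∷ []

θ* : List Letter → List Letter
θ* = concatMap θ

θ-palindrome : ∀ x → IsPalindrome (θ x)
θ-palindrome a = refl
θ-palindrome b = refl
θ-palindrome c = refl

θ*-palindrome : ∀ {P} → IsPalindrome P → IsPalindrome (θ* P)
θ*-palindrome {P} pal = trans (reverse-concatMap θ θ-palindrome P) (cong θ* pal)

data NotA : Letter → Set where
  b≠a : NotA b
  c≠a : NotA c

-- the words of a({b,c}a)⁺
data Framed : List Letter → Set where
  _∷a : ∀ {y} → NotA y → Framed (a ∷ y ∷ a ∷ [])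
  _∷_ : ∀ {y w} → NotA y → Framed w → Framed (a ∷ y ∷ w)

aca baca : List Letter
aca  = a ∷ c ∷ a ∷ []
baca = b ∷ aca

γ*-θ*-conjugate : ∀ {P} → Framed P → b ∷ γ* P ≡ θ* P ++ aca
γ*-θ*-conjugate (b≠a ∷a) = refl
γ*-θ*-conjugate (c≠a ∷a) = refl
γ*-θ*-conjugate (b≠a ∷ F) = cong (λ u → b ∷ a ∷ c ∷ a ∷ c ∷ a ∷ u) (γ*-θ*-conjugate F)
γ*-θ*-conjugate (c≠a ∷ F) = cong (λ u → b ∷ a ∷ c ∷ a ∷ u) (γ*-θ*-conjugate F)

framed-length-step : ∀ k {p q} → p + p ≤ 3 + q → suc (suc p) + suc (suc p) ≤ 3 + (4 + k + q)
framed-length-step k {p} {q} le = begin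
  suc (suc p) + suc (suc p) ≡⟨ cong (λ n → suc (suc n)) (trans (+-suc p (suc p)) (cong suc (+-suc p p))) ⟩
  4 + (p + p)               ≤⟨ +-monoʳ-≤ 4 le ⟩
  7 + q                     ≤⟨ +-monoʳ-≤ 7 (m≤n+m q k) ⟩
  3 + (4 + k + q)           ∎
  where open ≤-Reasoning

record Successor (P : List Letter) : Set where
  field
    word   : List Letter
    framed : Framed word
    θ*≡    : θ* P ≡ b ∷ word ++ [ b ]
    long   : length P + length P ≤ 3 + length word

successor : ∀ {P} → Framed P → Successor P
successor (c≠a ∷a) = record { word = aca ; framed = c≠a ∷a ; θ*≡ = refl ; long = ≤-refl }
successor (b≠a ∷a) = record
  { word = a ∷ c ∷ aca ; framed = c≠a ∷ (c≠a ∷a) ; θ*≡ = refl ; long = m≤m+n 6 2 }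
successor (c≠a ∷ F) = record
  { word   = a ∷ c ∷ a ∷ b ∷ word
  ; framed = c≠a ∷ (b≠a ∷ framed)
  ; θ*≡    = cong (λ u → b ∷ a ∷ c ∷ a ∷ u) θ*≡
  ; long   = framed-length-step 0 long
  }
  where open Successor (successor F)
successor (b≠a ∷ F) = record
  { word   = a ∷ c ∷ a ∷ c ∷ a ∷ b ∷ word
  ; framed = c≠a ∷ (c≠a ∷ (b≠a ∷ framed))
  ; θ*≡    = cong (λ u → b ∷ a ∷ c ∷ a ∷ c ∷ a ∷ u) θ*≡
  ; long   = framed-length-step 2 long
  }
  where open Successor (successor F)

module _ {P : List Letter} (F : Framed P) where
  open Successor (successor F)

  successor-palindrome : IsPalindrome P → IsPalindrome word
  successor-palindrome pal = palindrome-strip b word (subst IsPalindrome θ*≡ (θ*-palindrome pal))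

  γ*-successor : γ* P ≡ word ++ baca
  γ*-successor = ∷-injectiveʳ (begin
    b ∷ γ* P                    ≡⟨ γ*-θ*-conjugate F ⟩
    θ* P ++ aca                 ≡⟨ cong (_++ aca) θ*≡ ⟩
    b ∷ (word ++ [ b ]) ++ aca  ≡⟨ cong (b ∷_) (++-assoc word [ b ] aca) ⟩
    b ∷ word ++ baca            ∎)
    where open ≡-Reasoning

  successor-longer : 4 ≤ length P → length P < length word
  successor-longer 4≤P = +-cancelˡ-≤ 3 _ _ (begin
    3 + suc (length P)   ≡⟨ +-comm 4 (length P) ⟩
    length P + 4         ≤⟨ +-monoʳ-≤ (length P) 4≤P ⟩
    length P + length P  ≤⟨ long ⟩
    3 + length word      ∎)
    where open ≤-Reasoning

FactorOf : List Letter → List Letter → Set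
FactorOf w u = ∃₂ λ L R → u ≡ L ++ w ++ R

concatMap-factor : ∀ (f : Letter → List Letter) {w u} →
                   FactorOf w u → FactorOf (concatMap f w) (concatMap f u)
concatMap-factor f {w} (L , R , refl) = concatMap f L , concatMap f R , (begin
  concatMap f (L ++ w ++ R)                     ≡⟨ concatMap-++ f L (w ++ R) ⟩
  concatMap f L ++ concatMap f (w ++ R)         ≡⟨ cong (concatMap f L ++_) (concatMap-++ f w R) ⟩
  concatMap f L ++ concatMap f w ++ concatMap f R ∎)
  where open ≡-Reasoning

prefix-factor : ∀ {w v u} → FactorOf (w ++ v) u → FactorOf w u
prefix-factor {w} {v} (L , R , refl) = L , v ++ R , cong (L ++_) (++-assoc w v R)

γ*-∷ : ∀ x T → ∃₂ λ y U → γ* (x ∷ T) ≡ y ∷ U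
γ*-∷ a T = a , c ∷ a ∷ γ* T , refl
γ*-∷ b T = c , a ∷ b ∷ γ* T , refl
γ*-∷ c T = b , γ* T , refl

γⁿa-grows : ∀ n → ∃₂ λ x T → γⁿa (suc n) ≡ γⁿa n ++ x ∷ T
γⁿa-grows zero = c , a ∷ [] , refl
γⁿa-grows (suc n) with γⁿa-grows n
... | x , T , e with γ*-∷ x T
...   | y , U , e′ = y , U , (begin
  γ* (γⁿa (suc n))          ≡⟨ cong γ* e ⟩
  γ* (γⁿa n ++ x ∷ T)       ≡⟨ concatMap-++ γ (γⁿa n) (x ∷ T) ⟩
  γⁿa (suc n) ++ γ* (x ∷ T) ≡⟨ cong (γⁿa (suc n) ++_) e′ ⟩
  γⁿa (suc n) ++ y ∷ U      ∎)
  where open ≡-Reasoning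

γⁿa-prefix : ∀ {m n} → m ≤′ n → ∃ λ T → γⁿa n ≡ γⁿa m ++ T
γⁿa-prefix {m} ≤′-refl = [] , sym (++-identityʳ (γⁿa m))
γⁿa-prefix {m} (≤′-step {n} m≤n) with γⁿa-prefix m≤n | γⁿa-grows n
... | T , e | x , U , e′ = T ++ x ∷ U , (begin
  γⁿa (suc n)           ≡⟨ e′ ⟩
  γⁿa n ++ x ∷ U        ≡⟨ cong (_++ x ∷ U) e ⟩
  (γⁿa m ++ T) ++ x ∷ U ≡⟨ ++-assoc (γⁿa m) T (x ∷ U) ⟩
  γⁿa m ++ T ++ x ∷ U   ∎)
  where open ≡-Reasoning

length-γⁿa : ∀ n → n < length (γⁿa n)
length-γⁿa zero = s≤s z≤n
length-γⁿa (suc n) with γⁿa-grows n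
... | x , T , e = begin-strict
  suc n                           ≤⟨ length-γⁿa n ⟩
  length (γⁿa n)                  <⟨ m<m+n (length (γⁿa n)) (s≤s z≤n) ⟩
  length (γⁿa n) + length (x ∷ T) ≡⟨ length-++ (γⁿa n) ⟨
  length (γⁿa n ++ x ∷ T)         ≡⟨ cong length e ⟨
  length (γⁿa (suc n))            ∎
  where open ≤-Reasoning

at-++ˡ : ∀ u v {j} → j < length u → at (u ++ v) j ≡ at u j
at-++ˡ (x ∷ u) v {zero}  _         = refl
at-++ˡ (x ∷ u) v {suc j} (s≤s j<u) = at-++ˡ u v j<u

at-++ʳ : ∀ u v j → at (u ++ v) (length u + j) ≡ at v j
at-++ʳ []      v j = refl
at-++ʳ (x ∷ u) v j = at-++ʳ u v j

xγ-at : ∀ n {j} → j < length (γⁿa n) → xγ j ≡ at (γⁿa n) j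
xγ-at n {j} j<γⁿa with ≤-total (suc j) n
... | inj₁ sj≤n with γⁿa-prefix (≤⇒≤′ sj≤n)
...   | T , e = begin
  at (γⁿa (suc j)) j       ≡⟨ at-++ˡ (γⁿa (suc j)) T (<-trans (n<1+n j) (length-γⁿa (suc j))) ⟨
  at (γⁿa (suc j) ++ T) j  ≡⟨ cong (λ u → at u j) e ⟨
  at (γⁿa n) j             ∎
  where open ≡-Reasoning
xγ-at n {j} j<γⁿa | inj₂ n≤sj with γⁿa-prefix (≤⇒≤′ n≤sj)
...   | T , e = trans (cong (λ u → at u j) e) (at-++ˡ (γⁿa n) T j<γⁿa)

window-at : ∀ (x : ℕ → Letter) i w → (∀ j → j < length w → x (i + j) ≡ at w j) →
            window x i (length w) ≡ w
window-at x i []      agree = refl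
window-at x i (y ∷ w) agree = cong₂ _∷_
  (trans (cong x (sym (+-identityʳ i))) (agree 0 (s≤s z≤n)))
  (window-at x (suc i) w (λ j j<w → trans (cong x (sym (+-suc i j))) (agree (suc j) (s≤s j<w))))

γⁿa-factor⇒xγ-factor : ∀ n {w} → FactorOf w (γⁿa n) → IsFactor w xγ
γⁿa-factor⇒xγ-factor n {w} (L , R , e) = length L , window-at xγ (length L) w agree
  where
  inside : ∀ {j} → j < length w → length L + j < length (γⁿa n)
  inside {j} j<w = begin-strict
    length L + j                      <⟨ +-monoʳ-< (length L) (≤-trans j<w (m≤m+n (length w) (length R))) ⟩
    length L + (length w + length R)  ≡⟨ cong (length L +_) (length-++ w) ⟨
    length L + length (w ++ R)        ≡⟨ length-++ L ⟨
    length (L ++ w ++ R)              ≡⟨ cong length e ⟨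
    length (γⁿa n)                    ∎
    where open ≤-Reasoning

  agree : ∀ j → j < length w → xγ (length L + j) ≡ at w j
  agree j j<w = begin
    xγ (length L + j)                ≡⟨ xγ-at n (inside j<w) ⟩
    at (γⁿa n) (length L + j)        ≡⟨ cong (λ u → at u (length L + j)) e ⟩
    at (L ++ w ++ R) (length L + j)  ≡⟨ at-++ʳ L (w ++ R) j ⟩
    at (w ++ R) j                    ≡⟨ at-++ˡ w R j<w ⟩
    at w j                           ∎
    where open ≡-Reasoning

record LongFramedPalindrome (n : ℕ) : Set where
  field
    word       : List Letter
    framed     : Framed word
    palindrome : IsPalindrome word
    factor     : FactorOf word (γⁿa (2 + n))
    long       : 4 + n ≤ length word

longFramedPalindrome : ∀ n → LongFramedPalindrome n
longFramedPalindrome zero = record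
  { word       = γⁿa 2
  ; framed     = c≠a ∷ (b≠a ∷ (c≠a ∷a))
  ; palindrome = refl
  ; factor     = [] , [] , refl
  ; long       = m≤m+n 4 3
  }
longFramedPalindrome (suc n) = record
  { word       = Successor.word (successor framed)
  ; framed     = Successor.framed (successor framed)
  ; palindrome = successor-palindrome framed palindrome
  ; factor     = prefix-factor {v = baca}
                   (subst (λ w → FactorOf w (γⁿa (3 + n))) (γ*-successor framed) (concatMap-factor γ factor))
  ; long       = ≤-trans (s≤s long) (successor-longer framed (≤-trans (m≤m+n 4 n) long))
  }
  where open LongFramedPalindrome (longFramedPalindrome n)

mainTheorem5 : Palindromic xγ
mainTheorem5 n = word , ≤-trans (m≤n+m n 4) long , γⁿa-factor⇒xγ-factor (2 + n) factor , palindrome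
  where open LongFramedPalindrome (longFramedPalindrome n)
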